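{- Let $n \ge 1$ and let $P(X_1,\ldots,X_n) = \sum_{S \subseteq [n]} c_S \prod_{i \in S} X_i$ be a multilinear real polynomial that sign represents the parity function over $\{0,1\}^n$. Then for every $S \subseteq [n]$, $\mathrm{sgn}(c_S) = (-1)^{|S|}$ (in particular every $c_S$ is nonzero).
   Context: $[n] = \{1,\ldots,n\}$. The parity function on $\{0,1\}^n$ is $\mathrm{Par}(a_1,\ldots,a_n) = \sum_i a_i \bmod 2$. A polynomial $P$ sign represents $f: \{0,1\}^n \to \{0,1\}$ if for every $a \in \{0,1\}^n$: $f(a) = 0 \Rightarrow P(a) > 0$ and $f(a) = 1 \Rightarrow P(a) < 0$. $\mathrm{sgn}(c) \in \{+1,-1,0\}$ according as $c$ is positive, negative or zero. -}

module Defs where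

open import Level using (Level; _⊔_; suc)
open import Data.Sum using (_⊎_)
open import Data.Nat as ℕ using (ℕ; zero; _%_)
open import Data.Bool using (Bool; true; false; if_then_else_)
open import Data.Vec using (Vec; []; _∷_)
open import Data.Fin.Subset using (Subset; ∣_∣)
open import Algebra.Bundles using (CommutativeRing)
open import Relation.Binary.Core using (Rel)
open import Relation.Binary.PropositionalEquality using (_≡_)
open import Data.Product using (_×_)
open import Relation.Binary.Structures using (IsStrictPartialOrder)

-- The reals are an instance; stdlib has no ℝ.
record OrderedCommRing (c ℓ₁ ℓ₂ : Level) : Set (Level.suc (c ⊔ ℓ₁ ⊔ ℓ₂)) where
  field
    commutativeRing : CommutativeRing c ℓ₁
  open CommutativeRing commutativeRing public
  field
    _<_ : Rel Carrier ℓ₂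
    isStrictPartialOrder : IsStrictPartialOrder _≈_ _<_
    compare : ∀ x y → (x < y) ⊎ ((x ≈ y) ⊎ (y < x))
    +-monoˡ-< : ∀ {a b} c → a < b → (a + c) < (b + c)
    *-pos : ∀ {a b} → 0# < a → 0# < b → 0# < (a * b)

module _ {c ℓ₁ ℓ₂ : Level} (R : OrderedCommRing c ℓ₁ ℓ₂) where
  open OrderedCommRing R

  sumSubsets : (n : ℕ) → (Subset n → Carrier) → Carrier
  sumSubsets zero f = f []
  sumSubsets (ℕ.suc n) f =
    sumSubsets n (λ S → f (false ∷ S)) + sumSubsets n (λ S → f (true ∷ S))

  bit : Bool → Carrier
  bit true = 1#
  bit false = 0#

  monomial : {n : ℕ} → Subset n → Vec Bool n → Carrier
  monomial [] [] = 1#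
  monomial (s ∷ S) (x ∷ a) = (if s then bit x else 1#) * monomial S a

  evalML : {n : ℕ} → (Subset n → Carrier) → Vec Bool n → Carrier
  evalML {n} coef a = sumSubsets n (λ S → coef S * monomial S a)

  SignRepresents : {n : ℕ} → (Vec Bool n → Carrier) → (Vec Bool n → ℕ) → Set ℓ₂
  SignRepresents {n} P f = ∀ (a : Vec Bool n) →
    ((f a ≡ 0) → 0# < P a) × ((f a ≡ 1) → P a < 0#)

  SgnIsMinusOnePow : Carrier → ℕ → Set ℓ₂
  SgnIsMinusOnePow x k with k % 2
  ... | zero = 0# < x
  ... | ℕ.suc _ = x < 0#

Par : {n : ℕ} → Vec Bool n → ℕ
Par a = ∣ a ∣ % 2

{-# OPTIONS --safe #-}
module Submission where

-- Split off the first variable: P = P₀ + X₁ P₁ with P₀, P₁ in the remaining variables.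
-- P₀(a) = P(0,a) has sign (-1)^|a|, while P₀(a) + P₁(a) = P(1,a) has the opposite sign,
-- so P₁(a) has sign (-1)^(|a|+1).  Thus P₀ and P₁ sign-represent parity and its negation,
-- and induction on n, carrying the sign offset, ends at the constant c_S, reached after
-- passing |S| times to a P₁, so its sign is (-1)^|S|.

open import Defs
open import Level using (Level)
open import Function using (_∘_)
open import Data.Nat as ℕ using (ℕ; zero; suc; _≤_; _%_)
open import Data.Nat.Properties using (+-suc)
open import Data.Bool using (Bool; false; true)
open import Data.Vec using (Vec; []; _∷_)
open import Data.Fin.Subset using (Subset; ∣_∣)
open import Data.Product using (_×_; proj₁; proj₂)
open import Relation.Binary.Bundles using (StrictPartialOrder)
open import Relation.Binary.Structures using (IsStrictPartialOrder)
open import Relation.Binary.PropositionalEquality as ≡ using (_≡_; subst)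
import Algebra.Properties.AbelianGroup as AbelianGroupProperties
import Relation.Binary.Reasoning.StrictPartialOrder as StrictReasoning

module _ {c ℓ₁ ℓ₂ : Level} (R : OrderedCommRing c ℓ₁ ℓ₂) where
  open OrderedCommRing R
  open IsStrictPartialOrder isStrictPartialOrder using (<-respˡ-≈; <-respʳ-≈)
  open AbelianGroupProperties +-abelianGroup using (xyx⁻¹≈y)

  strictPartialOrder : StrictPartialOrder c ℓ₁ ℓ₂
  strictPartialOrder = record { isStrictPartialOrder = isStrictPartialOrder }

  open StrictReasoning strictPartialOrder

  sumSubsets-cong : ∀ n {f g : Subset n → Carrier} →
    (∀ S → f S ≈ g S) → sumSubsets R n f ≈ sumSubsets R n g
  sumSubsets-cong zero    f≈g = f≈g []
  sumSubsets-cong (suc n) f≈g =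
    +-cong (sumSubsets-cong n (f≈g ∘ (false ∷_))) (sumSubsets-cong n (f≈g ∘ (true ∷_)))

  sumSubsets-zero : ∀ n {f : Subset n → Carrier} →
    (∀ S → f S ≈ 0#) → sumSubsets R n f ≈ 0#
  sumSubsets-zero zero    f≈0 = f≈0 []
  sumSubsets-zero (suc n) {f} f≈0 = begin-equality
    sumSubsets R n (f ∘ (false ∷_)) + sumSubsets R n (f ∘ (true ∷_))
      ≈⟨ +-cong (sumSubsets-zero n (f≈0 ∘ (false ∷_))) (sumSubsets-zero n (f≈0 ∘ (true ∷_))) ⟩
    0# + 0#
      ≈⟨ +-identityʳ 0# ⟩
    0# ∎

  evalML-false∷ : ∀ {n} (coef : Subset (suc n) → Carrier) (a : Vec Bool n) →
    evalML R coef (false ∷ a) ≈ evalML R (coef ∘ (false ∷_)) a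
  evalML-false∷ {n} coef a = begin-equality
    evalML R coef (false ∷ a)
      ≈⟨ +-cong (sumSubsets-cong n (λ S → *-congˡ (*-identityˡ _)))
                (sumSubsets-zero n (λ S → trans (*-congˡ (zeroˡ _)) (zeroʳ _))) ⟩
    evalML R (coef ∘ (false ∷_)) a + 0#
      ≈⟨ +-identityʳ _ ⟩
    evalML R (coef ∘ (false ∷_)) a ∎

  evalML-true∷ : ∀ {n} (coef : Subset (suc n) → Carrier) (a : Vec Bool n) →
    evalML R coef (true ∷ a) ≈ evalML R (coef ∘ (false ∷_)) a + evalML R (coef ∘ (true ∷_)) a
  evalML-true∷ {n} coef a =
    +-cong (sumSubsets-cong n (λ S → *-congˡ (*-identityˡ _)))
           (sumSubsets-cong n (λ S → *-congˡ (*-identityˡ _)))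

  SgnIsMinusOnePow-resp-≈ : ∀ k {x y} → x ≈ y → SgnIsMinusOnePow R x k → SgnIsMinusOnePow R y k
  SgnIsMinusOnePow-resp-≈ zero          = <-respʳ-≈
  SgnIsMinusOnePow-resp-≈ (suc zero)    = <-respˡ-≈
  SgnIsMinusOnePow-resp-≈ (suc (suc k)) = SgnIsMinusOnePow-resp-≈ k

  SgnIsMinusOnePow-cancelˡ : ∀ k {u v} → SgnIsMinusOnePow R u k →
    SgnIsMinusOnePow R (u + v) (suc k) → SgnIsMinusOnePow R v (suc k)
  SgnIsMinusOnePow-cancelˡ zero {u} {v} 0<u u+v<0 = begin-strict
    v            ≈⟨ xyx⁻¹≈y u v ⟨
    u + v + - u  <⟨ +-monoˡ-< (- u) u+v<0 ⟩
    0# + - u     <⟨ +-monoˡ-< (- u) 0<u ⟩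
    u + - u      ≈⟨ -‿inverseʳ u ⟩
    0#           ∎
  SgnIsMinusOnePow-cancelˡ (suc zero) {u} {v} u<0 0<u+v = begin-strict
    0#           ≈⟨ -‿inverseʳ u ⟨
    u + - u      <⟨ +-monoˡ-< (- u) u<0 ⟩
    0# + - u     <⟨ +-monoˡ-< (- u) 0<u+v ⟩
    u + v + - u  ≈⟨ xyx⁻¹≈y u v ⟩
    v            ∎
  SgnIsMinusOnePow-cancelˡ (suc (suc k)) = SgnIsMinusOnePow-cancelˡ k

  -- sgn f(a) = (-1)^(e + |a|).  Since Subset n = Vec Bool n, it also applies to coefficients.
  ParitySigned : ∀ {n} → ℕ → (Vec Bool n → Carrier) → Set ℓ₂
  ParitySigned e f = ∀ a → SgnIsMinusOnePow R (f a) (e ℕ.+ ∣ a ∣)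

  ParitySigned-evalML-false∷ : ∀ {n} e (coef : Subset (suc n) → Carrier) →
    ParitySigned e (evalML R coef) → ParitySigned e (evalML R (coef ∘ (false ∷_)))
  ParitySigned-evalML-false∷ e coef signed a =
    SgnIsMinusOnePow-resp-≈ (e ℕ.+ ∣ a ∣) (evalML-false∷ coef a) (signed (false ∷ a))

  ParitySigned-evalML-true∷ : ∀ {n} e (coef : Subset (suc n) → Carrier) →
    ParitySigned e (evalML R coef) → ParitySigned (suc e) (evalML R (coef ∘ (true ∷_)))
  ParitySigned-evalML-true∷ e coef signed a =
    SgnIsMinusOnePow-cancelˡ (e ℕ.+ ∣ a ∣)
      (ParitySigned-evalML-false∷ e coef signed a)
      (SgnIsMinusOnePow-resp-≈ (suc (e ℕ.+ ∣ a ∣)) (evalML-true∷ coef a)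
        (subst (SgnIsMinusOnePow R _) (+-suc e ∣ a ∣) (signed (true ∷ a))))

  ParitySigned-∷ : ∀ {n} e (f : Vec Bool (suc n) → Carrier) →
    ParitySigned e (f ∘ (false ∷_)) → ParitySigned (suc e) (f ∘ (true ∷_)) → ParitySigned e f
  ParitySigned-∷ e f signed₀ signed₁ (false ∷ a) = signed₀ a
  ParitySigned-∷ e f signed₀ signed₁ (true ∷ a) =
    subst (SgnIsMinusOnePow R _) (≡.sym (+-suc e ∣ a ∣)) (signed₁ a)

  ParitySigned-coefficients : ∀ n e (coef : Subset n → Carrier) →
    ParitySigned e (evalML R coef) → ParitySigned e coef
  ParitySigned-coefficients zero e coef signed [] =
    SgnIsMinusOnePow-resp-≈ (e ℕ.+ 0) (*-identityʳ (coef [])) (signed [])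
  ParitySigned-coefficients (suc n) e coef signed =
    ParitySigned-∷ e coef
      (ParitySigned-coefficients n e _ (ParitySigned-evalML-false∷ e coef signed))
      (ParitySigned-coefficients n (suc e) _ (ParitySigned-evalML-true∷ e coef signed))

  SgnIsMinusOnePow-from-%2 : ∀ k {x} →
    ((k % 2 ≡ 0) → 0# < x) × ((k % 2 ≡ 1) → x < 0#) → SgnIsMinusOnePow R x k
  SgnIsMinusOnePow-from-%2 zero          signs = proj₁ signs ≡.refl
  SgnIsMinusOnePow-from-%2 (suc zero)    signs = proj₂ signs ≡.refl
  SgnIsMinusOnePow-from-%2 (suc (suc k)) signs = SgnIsMinusOnePow-from-%2 k signs

  SignRepresents-Par⇒ParitySigned : ∀ {n} (P : Vec Bool n → Carrier) →
    SignRepresents R P Par → ParitySigned 0 P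
  SignRepresents-Par⇒ParitySigned P represents a = SgnIsMinusOnePow-from-%2 ∣ a ∣ (represents a)

theorem3p3 : ∀ {c ℓ₁ ℓ₂ : Level} (R : OrderedCommRing c ℓ₁ ℓ₂) (n : ℕ) → 1 ≤ n →
    (coef : Subset n → OrderedCommRing.Carrier R) →
    SignRepresents R (evalML R coef) Par →
    ∀ (S : Subset n) → SgnIsMinusOnePow R (coef S) ∣ S ∣
theorem3p3 R n _ coef represents =
  ParitySigned-coefficients R n 0 coef (SignRepresents-Par⇒ParitySigned R (evalML R coef) represents)
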